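{- Let $\mathcal G=(V,E)$ be an embedded proper level-planar graph (containing the boundary paths $p_L,p_R$), let $\lambda\in\mathbb N$ and let $\varphi$ be a circulation in $F_{\mathcal G}^\lambda$. Then the dual $\varphi^\star$, interpreted as assigning an $x$-coordinate to each vertex of $\mathcal G$, defines a $\lambda$-drawing of $\mathcal G$.
   Context: A $k$-level graph is a directed graph $G=(V,E)$ with $\ell:V\to\{1,\dots,k\}$; proper means $\ell(v)=\ell(u)+1$ for every edge $(u,v)$. A level drawing places $v$ at $(\Gamma(v),\ell(v))$, edges as $y$-monotone curves; level-planar means no crossings except at common endpoints. An embedding of a proper level graph is a left-to-right order of the vertices on each level (as induced by a level-planar drawing); an embedded level graph is a level graph with an embedding; two vertices on a level are consecutive if adjacent in that order. The slope of $(u,v)$ is $\Gamma(v)-\Gamma(u)$. A $\lambda$-drawing is a straight-line level-planar drawing inducing the given embedding with all slopes in $\{0,\dots,\lambda-1\}$. Standing convention: $\mathcal G$ contains a left boundary path $p_L$ and right boundary path $p_R$, each a directed path with one vertex on each level $1,\dots,k$, leftmost resp. rightmost on their levels; $n=|V|$; $v_R$ denotes the level-1 vertex of $p_R$. Flow network / circulation: arcs with demands $d$ and capacities $c$; a circulation is an integer $\varphi\ge 0$ with $d(a)\le\varphi(a)\le c(a)$ and flow conservation at each node. $F_{\mathcal G}^\lambda$: add to a level-planar drawing of $\mathcal G$ a horizontal segment between each two consecutive vertices of each level, giving a plane graph $\mathcal G'$. Nodes: one per bounded face of $\mathcal G'$, plus $s$ (outside region right of $p_R$ and below level 1) and $t$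 (outside region left of $p_L$ and above level $k$). Arcs: for each edge $e=(u,w)$ of $\mathcal G$ a slope arc $e^\star$ from the region on the right of $e$ to the region on its left, demand $0$, capacity $\lambda-1$; for each consecutive pair $u,v$ on a level ($u$ left of $v$) a space arc $[u,v]^\star$ from the region below segment $uv$ to the region above it, demand $1$, capacity $(\lambda-1)(n-1)$; an arc $(t,s)$ with demand 0 and unlimited capacity. Dual $\varphi^\star:V\to\mathbb Z$: set $\varphi^\star(v_R)=0$; process the vertices of $p_R$ by increasing level, setting $\varphi^\star(v)=\varphi^\star(u)+\varphi((u,v)^\star)$ for each edge $(u,v)$ of $p_R$; then for consecutive vertices $w,x$ on a level with $w$ left of $x$ and $\varphi^\star(x)$ already set, put $\varphi^\star(w)=\varphi^\star(x)+\varphi([w,x]^\star)$. -}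

module Defs where

open import Data.Nat using (ℕ; zero; suc; _+_; _*_; _∸_; _≤_; _<_; _≡ᵇ_; _≤ᵇ_; _<?_)
open import Data.Bool using (Bool; true; false; _∧_; if_then_else_; not)
open import Data.Fin using (Fin; toℕ; inject₁; fromℕ; fromℕ<) renaming (zero to fzero; suc to fsuc; _<_ to _<ᶠ_; _≤_ to _≤ᶠ_)
open import Data.List using (List; []; _∷_; map; concatMap; filterᵇ; last; head; mapMaybe; allFin)
open import Data.Nat.ListAction using (sum)
open import Data.List.Membership.Propositional using (_∈_)
open import Data.Maybe using (Maybe; just; nothing; fromMaybe; maybe)
open import Data.Product using (Σ; _×_; _,_; proj₁; proj₂)
open import Data.Unit using (⊤)
open import Data.Integer using (ℤ; +_) renaming (_+_ to _+ℤ_; _-_ to _-ℤ_; _≤_ to _≤ℤ_; _<_ to _<ℤ_)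
open import Relation.Nullary using (yes; no)
open import Relation.Binary.PropositionalEquality using (_≡_)

-- Levels are Fin (suc m) (level ℓ of the paper is ℓ+1 here, k = suc m).
-- Level ℓ has  width ℓ = suc (pw ℓ)  vertices, Fin (width ℓ), and the
-- embedding (left-to-right order) is the index order of Fin (width ℓ).
-- Edges are proper: an edge of strip j goes from level inject₁ j to
-- level fsuc j (edge j a b = true means (a,b) is an edge).

record LevelGraph : Set where
  field
    m     : ℕ
    pw    : Fin (suc m) → ℕ
    edge  : (j : Fin m) → Fin (suc (pw (inject₁ j))) → Fin (suc (pw (fsuc j))) → Bool

module _ (G : LevelGraph) where
  open LevelGraph G

  width : Fin (suc m) → ℕ
  width ℓ = suc (pw ℓ)

  Vertex : Set
  Vertex = Σ (Fin (suc m)) (λ ℓ → Fin (width ℓ))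

  numVertices : ℕ
  numVertices = sum (map width (allFin (suc m)))

  lastOf : (ℓ : Fin (suc m)) → Fin (width ℓ)
  lastOf ℓ = fromℕ (pw ℓ)

  -- The left boundary path p_L consists of the leftmost vertices and the
  -- right boundary path p_R of the rightmost vertices.
  record IsEmbeddedWithBoundary : Set where
    field
      planar : ∀ j a b c d → edge j a b ≡ true → edge j c d ≡ true →
               a <ᶠ c → b ≤ᶠ d
      leftPath  : ∀ j → edge j fzero fzero ≡ true
      rightPath : ∀ j → edge j (lastOf (inject₁ j)) (lastOf (fsuc j)) ≡ true

  edgesIn : (j : Fin m) → List (Fin (width (inject₁ j)) × Fin (width (fsuc j)))
  edgesIn j = concatMap (λ a → map (λ b → (a , b))
                  (filterᵇ (λ b → edge j a b) (allFin _)))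
                (allFin _)

  -- Every bounded face lies in a
  -- strip j between two consecutive edges of that strip; it is named
  -- face j a b after the edge (a,b) on its left boundary.
  data Node : Set where
    s t  : Node
    face : (j : Fin m) → Fin (width (inject₁ j)) → Fin (width (fsuc j)) → Node

  eqNode : Node → Node → Bool
  eqNode s s = true
  eqNode t t = true
  eqNode (face j a b) (face j' a' b') =
    (toℕ j ≡ᵇ toℕ j') ∧ ((toℕ a ≡ᵇ toℕ a') ∧ (toℕ b ≡ᵇ toℕ b'))
  eqNode _ _ = false

  isLastEdge : (j : Fin m) → Fin (width (inject₁ j)) → Fin (width (fsuc j)) → Bool
  isLastEdge j a b = (toℕ a ≡ᵇ pw (inject₁ j)) ∧ (toℕ b ≡ᵇ pw (fsuc j))

  -- the bounded faces: one to the right of every edge except the edge of p_R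
  nodes : List Node
  nodes = s ∷ t ∷ concatMap
            (λ j → map (λ e → face j (proj₁ e) (proj₂ e))
                       (filterᵇ (λ e → not (isLastEdge j (proj₁ e) (proj₂ e))) (edgesIn j)))
            (allFin m)

  lexLess : ∀ {A B : ℕ} → Fin A × Fin B → Fin A × Fin B → Bool
  lexLess (a , b) (c , d) =
    (suc (toℕ a) ≤ᵇ toℕ c) ∨' ((toℕ a ≡ᵇ toℕ c) ∧ (suc (toℕ b) ≤ᵇ toℕ d))
    where
    _∨'_ : Bool → Bool → Bool
    true ∨' _ = true
    false ∨' y = y

  rightOf : (j : Fin m) → Fin (width (inject₁ j)) → Fin (width (fsuc j)) → Node
  rightOf j a b = if isLastEdge j a b then s else face j a b

  leftOf : (j : Fin m) → Fin (width (inject₁ j)) → Fin (width (fsuc j)) → Node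
  leftOf j a b = maybe (λ e → face j (proj₁ e) (proj₂ e)) t
                   (last (filterᵇ (λ e → lexLess e (a , b)) (edgesIn j)))

  -- the face of strip j whose boundary contains a given horizontal segment:
  -- the last face (in left-to-right order) whose left edge satisfies P
  faceWhere : (j : Fin m) → (Fin (width (inject₁ j)) × Fin (width (fsuc j)) → Bool) → Maybe Node
  faceWhere j P = Data.Maybe.map (λ e → face j (proj₁ e) (proj₂ e)) (last (filterᵇ P (edgesIn j)))

  -- region below / above the segment between vertices p and p+1 of level ℓ
  below : (ℓ : Fin (suc m)) → Fin (width ℓ) → Node
  below ℓ p = fromMaybe s (head (mapMaybe
    (λ j → if suc (toℕ j) ≡ᵇ toℕ ℓ
             then faceWhere j (λ e → toℕ (proj₂ e) ≤ᵇ toℕ p) else nothing)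
    (allFin m)))

  above : (ℓ : Fin (suc m)) → Fin (width ℓ) → Node
  above ℓ p = fromMaybe t (head (mapMaybe
    (λ j → if toℕ j ≡ᵇ toℕ ℓ
             then faceWhere j (λ e → toℕ (proj₁ e) ≤ᵇ toℕ p) else nothing)
    (allFin m)))

  -- Arcs: slope arcs e*, space arcs [u,v]* (named by the level and the index
  -- of the left vertex u), and the arc (t,s).
  data Arc : Set where
    slope : (j : Fin m) → Fin (width (inject₁ j)) → Fin (width (fsuc j)) → Arc
    space : (ℓ : Fin (suc m)) → Fin (width ℓ) → Arc
    ts    : Arc

  arcs : List Arc
  arcs = concatMap (λ j → map (λ e → slope j (proj₁ e) (proj₂ e)) (edgesIn j)) (allFin m)
    Data.List.++
         concatMap (λ ℓ → map (space ℓ) (filterᵇ (λ p → suc (toℕ p) ≤ᵇ pw ℓ) (allFin (width ℓ))))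
                   (allFin (suc m))
    Data.List.++ (ts ∷ [])

  tail head' : Arc → Node
  tail (slope j a b) = rightOf j a b
  tail (space ℓ p)   = below ℓ p
  tail ts            = t
  head' (slope j a b) = leftOf j a b
  head' (space ℓ p)   = above ℓ p
  head' ts            = s

  demand : Arc → ℕ
  demand (slope _ _ _) = 0
  demand (space _ _)   = 1
  demand ts            = 0

  -- φ(a) ≤ c(a), written without truncated subtraction:
  --   slope: φ ≤ λ - 1          ⇔ φ + 1 ≤ λ
  --   space: φ ≤ (λ-1)(n-1)     ⇔ φ + (n-1) ≤ λ (n-1)
  --   (t,s): unlimited
  withinCapacity : ℕ → Arc → ℕ → Set
  withinCapacity λ' (slope _ _ _) f = f + 1 ≤ λ'
  withinCapacity λ' (space _ _)   f = f + (numVertices ∸ 1) ≤ λ' * (numVertices ∸ 1)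
  withinCapacity λ' ts            f = ⊤

  inflow outflow : (Arc → ℕ) → Node → ℕ
  inflow  φ v = sum (map φ (filterᵇ (λ a → eqNode (head' a) v) arcs))
  outflow φ v = sum (map φ (filterᵇ (λ a → eqNode (tail a) v) arcs))

  record IsCirculation (λ' : ℕ) (φ : Arc → ℕ) : Set where
    field
      lower    : ∀ a → a ∈ arcs → demand a ≤ φ a
      upper    : ∀ a → a ∈ arcs → withinCapacity λ' a (φ a)
      conserve : ∀ v → v ∈ nodes → inflow φ v ≡ outflow φ v

  module _ (φ : Arc → ℕ) where

    rSlope : ℕ → ℕ
    rSlope j with j <? m
    ... | yes j<m = φ (slope (fromℕ< j<m) (lastOf _) (lastOf _))
    ... | no _    = 0

    -- φ* on the vertex of p_R on level j (processing p_R by increasing level)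
    dualR : ℕ → ℤ
    dualR zero    = + 0
    dualR (suc j) = dualR j +ℤ + rSlope j

    spaceFlow : (ℓ : Fin (suc m)) → ℕ → ℕ
    spaceFlow ℓ q with q <? width ℓ
    ... | yes q<w = φ (space ℓ (fromℕ< q<w))
    ... | no _    = 0

    -- φ* on the vertex of level ℓ at distance d from the right end
    dualH : (ℓ : Fin (suc m)) → ℕ → ℤ
    dualH ℓ zero    = dualR (toℕ ℓ)
    dualH ℓ (suc d) = dualH ℓ d -ℤ + spaceFlow ℓ (pw ℓ ∸ suc d)

    dual : Vertex → ℤ
    dual (ℓ , p) = dualH ℓ (pw ℓ ∸ toℕ p)

  -- λ-drawings: straight-line level-planar drawings (vertex v at
  -- (x v, level of v)) inducing the given embedding, slopes in {0,…,λ-1}.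
  record IsLambdaDrawing (λ' : ℕ) (x : Vertex → ℤ) : Set where
    field
      order  : ∀ ℓ (p q : Fin (width ℓ)) → p <ᶠ q → x (ℓ , p) <ℤ x (ℓ , q)
      noCross : ∀ j a b c d → edge j a b ≡ true → edge j c d ≡ true →
                x (inject₁ j , a) <ℤ x (inject₁ j , c) →
                x (fsuc j , b) ≤ℤ x (fsuc j , d)
      slopeLow  : ∀ j a b → edge j a b ≡ true → x (inject₁ j , a) ≤ℤ x (fsuc j , b)
      slopeHigh : ∀ j a b → edge j a b ≡ true → x (fsuc j , b) <ℤ x (inject₁ j , a) +ℤ + λ'

-- A bounded face of strip j lies between two consecutive edges (a,b) and (c,d)
-- of the strip; the arcs through it are the slope arcs of both edges and the
-- space arcs of the segments [a,c] below and [b,d] above it.  Along a level φ*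
-- grows by the flow on the space arcs, so conservation at the face says exactly
-- that φ*(b) − φ*(a) = φ((a,b)*) as soon as φ*(d) − φ*(c) = φ((c,d)*).  For the
-- edge of p_R this holds by the definition of φ*, so by induction from the right
-- every edge e has slope φ(e*), which the capacity bounds by λ−1.  The demand 1
-- on space arcs makes φ* strictly increasing along each level, which gives the
-- embedding, and planarity of the embedding then rules out crossings.
module Submission where

open import Algebra.Properties.CommutativeSemigroup using (interchange)
open import Data.Bool using (Bool; true; false; _∧_; if_then_else_; not; T)
open import Data.Bool.Properties using (T-≡; ⇔→≡; ¬-not; not-injective; ∧-identityʳ; ∧-zeroʳ)
open import Data.Empty using (⊥-elim)
open import Data.Fin using (Fin; toℕ; inject₁; fromℕ<) renaming (zero to fzero; suc to fsuc)
open import Data.Fin.Properties using (toℕ-injective; toℕ-inject₁; toℕ-fromℕ; toℕ<n; toℕ≤pred[n]; fromℕ<-toℕ; toℕ-fromℕ<)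
  renaming (suc-injective to fsuc-injective)
open import Data.Integer using (ℤ; +_; +<+) renaming (_+_ to _+ℤ_; _-_ to _-ℤ_; _≤_ to _≤ℤ_; _<_ to _<ℤ_)
import Data.Integer.Properties as ℤ
open import Data.Integer.Tactic.RingSolver using (solve-∀)
open import Data.List using (List; []; _∷_; _++_; map; catMaybes; concatMap; filterᵇ; last; head; mapMaybe; allFin)
open import Data.List.Membership.Propositional using (_∈_)
open import Data.List.Membership.Propositional.Properties
  using (∈-++⁻; ∈-++⁺ˡ; ∈-++⁺ʳ; ∈-map⁻; ∈-map⁺; ∈-filter⁺; ∈-filter⁻; ∈-allFin; ∈-concat⁺′; ∈-concat⁻′; ∈-∃++)
open import Data.List.Properties
  using (++-assoc; ++-identityʳ; map-++; map-∘; map-cong; map-tabulate; mapMaybe-cong; mapMaybe-nothing; filter-++; filter-accept; filter-reject)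
open import Data.List.Relation.Unary.Any using (here; there)
open import Data.List.Relation.Unary.All as All using (All; []; _∷_)
import Data.List.Relation.Unary.All.Properties as All
open import Data.List.Relation.Unary.AllPairs using (AllPairs; []; _∷_)
import Data.List.Relation.Unary.AllPairs.Properties as AllPairs
open import Data.Maybe using (Maybe; just; nothing; fromMaybe; maybe)
import Data.Maybe as Maybe
open import Data.Nat using (ℕ; zero; suc; _+_; _∸_; _≤_; _<_; _≡ᵇ_; _≤ᵇ_; s≤s; _<?_; _≤?_)
open import Data.Nat.ListAction using (sum)
open import Data.Nat.ListAction.Properties using (sum-++)
open import Data.Nat.Properties
open import Data.Product using (Σ; ∃; _×_; _,_; proj₁; proj₂)
open import Data.Sum using (_⊎_; inj₁; inj₂)
open import Function using (_∘_; id; Equivalence; mk⇔)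
open import Relation.Binary.Definitions using (tri<; tri≈; tri>)
open import Relation.Binary.PropositionalEquality
open import Relation.Nullary using (¬_; yes; no)
open import Relation.Nullary.Decidable using (T?)

open import Defs

private variable
  A B : Set

T-true : ∀ {b} → b ≡ true → T b
T-true = Equivalence.from T-≡

T-false : ∀ {b} → b ≡ false → ¬ T b
T-false refl ()

true≢false : true ≢ false
true≢false ()

∧-true⁻ : ∀ {b c} → (b ∧ c) ≡ true → b ≡ true × c ≡ true
∧-true⁻ {true} {true} _ = refl , refl

if-true : ∀ {b} {x y : A} → b ≡ true → (if b then x else y) ≡ x
if-true refl = refl

if-false : ∀ {b} {x y : A} → b ≡ false → (if b then x else y) ≡ y
if-false refl = refl

if-nothing⁻ : ∀ {b} {M : Maybe A} {x} → (if b then M else nothing) ≡ just x → b ≡ true × M ≡ just x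
if-nothing⁻ {b = true} e = refl , e

≤ᵇ-true : ∀ {m n} → m ≤ n → (m ≤ᵇ n) ≡ true
≤ᵇ-true m≤n = Equivalence.to T-≡ (≤⇒≤ᵇ m≤n)

≤ᵇ-true⁻ : ∀ {m n} → (m ≤ᵇ n) ≡ true → m ≤ n
≤ᵇ-true⁻ {m} {n} e = ≤ᵇ⇒≤ m n (T-true e)

≤ᵇ-false : ∀ {m n} → n < m → (m ≤ᵇ n) ≡ false
≤ᵇ-false {m} {n} n<m = ¬-not (λ e → <⇒≱ n<m (≤ᵇ-true⁻ e))

≤ᵇ-false⁻ : ∀ {m n} → (m ≤ᵇ n) ≡ false → n < m
≤ᵇ-false⁻ m≰n = ≰⇒> (λ m≤n → true≢false (trans (sym (≤ᵇ-true m≤n)) m≰n))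

not-≤ᵇ : ∀ m n → not (m ≤ᵇ n) ≡ (suc n ≤ᵇ m)
not-≤ᵇ m n with m ≤? n
... | yes m≤n rewrite ≤ᵇ-true m≤n | ≤ᵇ-false {suc n} (s≤s m≤n) = refl
... | no m≰n rewrite ≤ᵇ-false {m} (≰⇒> m≰n) | ≤ᵇ-true (≰⇒> m≰n) = refl

≡ᵇ-true : ∀ {m n} → m ≡ n → (m ≡ᵇ n) ≡ true
≡ᵇ-true {m} {n} m≡n = Equivalence.to T-≡ (≡⇒≡ᵇ m n m≡n)

≡ᵇ-true⁻ : ∀ {m n} → (m ≡ᵇ n) ≡ true → m ≡ n
≡ᵇ-true⁻ {m} {n} e = ≡ᵇ⇒≡ m n (T-true e)

≡ᵇ-false : ∀ {m n} → m ≢ n → (m ≡ᵇ n) ≡ false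
≡ᵇ-false m≢n = ¬-not (m≢n ∘ ≡ᵇ-true⁻)

sum-map-++ : (f : A → ℕ) (xs ys : List A) → sum (map f (xs ++ ys)) ≡ sum (map f xs) + sum (map f ys)
sum-map-++ f xs ys = trans (cong sum (map-++ f xs ys)) (sum-++ (map f xs) (map f ys))

sum-map-+ : (f g : A → ℕ) (xs : List A) → sum (map (λ x → f x + g x) xs) ≡ sum (map f xs) + sum (map g xs)
sum-map-+ f g [] = refl
sum-map-+ f g (x ∷ xs) =
  trans (cong (_+_ (f x + g x)) (sum-map-+ f g xs)) (interchange +-commutativeSemigroup (f x) (g x) _ _)

sum-map-filterᵇ : (P : A → Bool) (f : A → ℕ) (xs : List A) →
  sum (map f (filterᵇ P xs)) ≡ sum (map (λ x → if P x then f x else 0) xs)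
sum-map-filterᵇ P f [] = refl
sum-map-filterᵇ P f (x ∷ xs) with P x
... | true = cong (_+_ (f x)) (sum-map-filterᵇ P f xs)
... | false = sum-map-filterᵇ P f xs

sum-map-zero : (f : A → ℕ) (xs : List A) → (∀ {x} → x ∈ xs → f x ≡ 0) → sum (map f xs) ≡ 0
sum-map-zero f [] _ = refl
sum-map-zero f (x ∷ xs) f≡0 rewrite f≡0 (here refl) = sum-map-zero f xs (f≡0 ∘ there)

sum-map-concatMap : (h : B → ℕ) (f : A → List B) (xs : List A) →
  sum (map h (concatMap f xs)) ≡ sum (map (λ x → sum (map h (f x))) xs)
sum-map-concatMap h f [] = refl
sum-map-concatMap h f (x ∷ xs) =
  trans (sum-map-++ h (f x) _) (cong (_+_ (sum (map h (f x)))) (sum-map-concatMap h f xs))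

sum-map-∘ : (h : B → ℕ) (g : A → B) (xs : List A) → sum (map h (map g xs)) ≡ sum (map (h ∘ g) xs)
sum-map-∘ h g xs = cong sum (sym (map-∘ xs))

sum-map-pair : (f : A → ℕ) (pre : List A) (y y′ : A) (post : List A) →
  (∀ {z} → z ∈ pre → f z ≡ 0) → (∀ {z} → z ∈ post → f z ≡ 0) → sum (map f (pre ++ y ∷ y′ ∷ post)) ≡ f y + f y′
sum-map-pair f pre y y′ post pre≡0 post≡0
  rewrite sum-map-++ f pre (y ∷ y′ ∷ post) | sum-map-zero f pre pre≡0 | sum-map-zero f post post≡0 =
  trans (sym (+-assoc (f y) (f y′) 0)) (+-identityʳ _)

map-allFin-suc : ∀ {n} (g : Fin (suc n) → A) → map g (allFin (suc n)) ≡ g fzero ∷ map (g ∘ fsuc) (allFin n)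
map-allFin-suc g = cong (g fzero ∷_) (trans (map-tabulate fsuc g) (sym (map-tabulate id (g ∘ fsuc))))

sum-allFin-point : ∀ {n} (g : Fin n → ℕ) (i : Fin n) → (∀ k → k ≢ i → g k ≡ 0) → sum (map g (allFin n)) ≡ g i
sum-allFin-point {suc n} g i g≡0 = trans (cong sum (map-allFin-suc g)) (split i g≡0)
  where
  split : ∀ i → (∀ k → k ≢ i → g k ≡ 0) → g fzero + sum (map (g ∘ fsuc) (allFin n)) ≡ g i
  split fzero g≡0 =
    trans (cong (_+_ (g fzero)) (sum-map-zero (g ∘ fsuc) (allFin n) (λ {k} _ → g≡0 (fsuc k) λ ()))) (+-identityʳ _)
  split (fsuc i) g≡0 rewrite g≡0 fzero (λ ()) =
    sum-allFin-point (g ∘ fsuc) i (λ k k≢i → g≡0 (fsuc k) (k≢i ∘ fsuc-injective))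

head-mapMaybe-just : (g : A → Maybe B) (xs : List A) {y : B} → head (mapMaybe g xs) ≡ just y → ∃ λ x → g x ≡ just y
head-mapMaybe-just g (x ∷ xs) e with g x in gx
... | just _ = x , trans gx e
... | nothing = head-mapMaybe-just g xs e

head-mapMaybe-allFin-point : ∀ {n} (g : Fin n → Maybe A) (i : Fin n) → (∀ k → k ≢ i → g k ≡ nothing) →
  head (mapMaybe g (allFin n)) ≡ g i
head-mapMaybe-allFin-point {n = suc n} g i g≡nothing = trans (cong (head ∘ catMaybes) (map-allFin-suc g)) (after-fzero i g≡nothing)
  where
  after-fzero : ∀ i → (∀ k → k ≢ i → g k ≡ nothing) → head (catMaybes (g fzero ∷ map (g ∘ fsuc) (allFin n))) ≡ g i
  after-fzero fzero g≡nothing with g fzero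
  ... | just _ = refl
  ... | nothing = cong head (trans (mapMaybe-cong (λ k → g≡nothing (fsuc k) λ ()) (allFin n)) (mapMaybe-nothing (allFin n)))
  after-fzero (fsuc i) g≡nothing rewrite g≡nothing fzero (λ ()) =
    head-mapMaybe-allFin-point (g ∘ fsuc) i (λ k k≢i → g≡nothing (fsuc k) (k≢i ∘ fsuc-injective))

fromMaybe-map : (f : A → B) (d : B) (M : Maybe A) → fromMaybe d (Maybe.map f M) ≡ maybe f d M
fromMaybe-map f d (just x) = refl
fromMaybe-map f d nothing = refl

last-∷ʳ : (xs : List A) (y : A) → last (xs ++ y ∷ []) ≡ just y
last-∷ʳ [] y = refl
last-∷ʳ (x ∷ []) y = refl
last-∷ʳ (x ∷ x′ ∷ xs) y = last-∷ʳ (x′ ∷ xs) y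

last-∈ : (xs : List A) {w : A} → last xs ≡ just w → w ∈ xs
last-∈ (x ∷ []) refl = here refl
last-∈ (x ∷ x′ ∷ xs) e = there (last-∈ (x′ ∷ xs) e)

last-++-∈ : (xs : List A) (z : A) (zs : List A) {w : A} → last (xs ++ z ∷ zs) ≡ just w → w ∈ z ∷ zs
last-++-∈ [] z zs e = last-∈ (z ∷ zs) e
last-++-∈ (x ∷ []) z zs e = last-++-∈ [] z zs e
last-++-∈ (x ∷ x′ ∷ xs) z zs e = last-++-∈ (x′ ∷ xs) z zs e

filterᵇ-none : (Q : A → Bool) (xs : List A) → (∀ {x} → x ∈ xs → Q x ≡ false) → filterᵇ Q xs ≡ []
filterᵇ-none Q [] _ = refl
filterᵇ-none Q (x ∷ xs) Q≡false =
  trans (filter-reject (T? ∘ Q) (T-false (Q≡false (here refl)))) (filterᵇ-none Q xs (Q≡false ∘ there))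

AllPairs-++⁻ : ∀ {R : A → A → Set} (xs : List A) {ys : List A} → AllPairs R (xs ++ ys) →
  All (λ x → All (R x) ys) xs × AllPairs R ys
AllPairs-++⁻ [] sorted = [] , sorted
AllPairs-++⁻ (x ∷ xs) (x<xs ∷ sorted) = let (xs<ys , ys-sorted) = AllPairs-++⁻ xs sorted in
  (All.++⁻ʳ xs x<xs ∷ xs<ys) , ys-sorted

module SortedSplit {R : A → A → Set} (R-trans : ∀ {x y z} → R x y → R y z → R x z) (R-irrefl : ∀ {x} → ¬ R x x)
                   (pre : List A) (y y′ : A) (post : List A) (sorted : AllPairs R (pre ++ y ∷ y′ ∷ post)) where

  L : List A
  L = pre ++ y ∷ y′ ∷ post

  pre<y : ∀ {z} → z ∈ pre → R z y
  pre<y z∈pre with All.lookup (proj₁ (AllPairs-++⁻ pre sorted)) z∈pre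
  ... | z<y ∷ _ = z<y

  y<y′ : R y y′
  y<y′ with proj₂ (AllPairs-++⁻ pre sorted)
  ... | (y<y′ ∷ _) ∷ _ = y<y′

  y′<post : ∀ {z} → z ∈ post → R y′ z
  y′<post z∈post with proj₂ (AllPairs-++⁻ pre sorted)
  ... | _ ∷ (y′<post ∷ _) = All.lookup y′<post z∈post

  ∈-post : ∀ {z} → z ∈ post → z ∈ L
  ∈-post z∈post = ∈-++⁺ʳ pre (there (there z∈post))

  ∈-y : y ∈ L
  ∈-y = ∈-++⁺ʳ pre (here refl)

  ∈-y′ : y′ ∈ L
  ∈-y′ = ∈-++⁺ʳ pre (there (here refl))

  module _ (Q : A → Bool) (Q-down : ∀ {u w} → u ∈ L → w ∈ L → R u w → Q w ≡ true → Q u ≡ true) where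

    Q-false-after-y′ : Q y′ ≡ false → ∀ {z} → z ∈ post → Q z ≡ false
    Q-false-after-y′ Qy′ z∈post =
      ¬-not (λ Qz → true≢false (trans (sym (Q-down ∈-y′ (∈-post z∈post) (y′<post z∈post) Qz)) Qy′))

    last-filterᵇ : Q y ≡ true → Q y′ ≡ false → last (filterᵇ Q L) ≡ just y
    last-filterᵇ Qy Qy′ = begin
      last (filterᵇ Q L)                                ≡⟨ cong last (filter-++ (T? ∘ Q) pre (y ∷ y′ ∷ post)) ⟩
      last (filterᵇ Q pre ++ filterᵇ Q (y ∷ y′ ∷ post)) ≡⟨ cong (λ zs → last (filterᵇ Q pre ++ zs)) from-y ⟩
      last (filterᵇ Q pre ++ y ∷ [])                     ≡⟨ last-∷ʳ (filterᵇ Q pre) y ⟩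
      just y                                            ∎
      where
      open ≡-Reasoning
      from-y : filterᵇ Q (y ∷ y′ ∷ post) ≡ y ∷ []
      from-y = trans (filter-accept (T? ∘ Q) (T-true Qy)) (cong (y ∷_)
                 (trans (filter-reject (T? ∘ Q) (T-false Qy′)) (filterᵇ-none Q post (Q-false-after-y′ Qy′))))

    last-filterᵇ⁻ : last (filterᵇ Q L) ≡ just y → Q y ≡ true × Q y′ ≡ false
    last-filterᵇ⁻ last≡y with Q y in Qy | Q y′ in Qy′
    ... | true | false = refl , refl
    ... | _ | true = ⊥-elim (R-irrefl (after-y (last-++-∈ (filterᵇ Q (pre ++ y ∷ [])) y′ (filterᵇ Q post) last-split≡y)))
      where
      split-at-y′ : filterᵇ Q L ≡ filterᵇ Q (pre ++ y ∷ []) ++ y′ ∷ filterᵇ Q post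
      split-at-y′ = begin
        filterᵇ Q L                                          ≡⟨ cong (filterᵇ Q) (sym (++-assoc pre (y ∷ []) (y′ ∷ post))) ⟩
        filterᵇ Q ((pre ++ y ∷ []) ++ y′ ∷ post)              ≡⟨ filter-++ (T? ∘ Q) (pre ++ y ∷ []) (y′ ∷ post) ⟩
        filterᵇ Q (pre ++ y ∷ []) ++ filterᵇ Q (y′ ∷ post)    ≡⟨ cong (filterᵇ Q (pre ++ y ∷ []) ++_) (filter-accept (T? ∘ Q) (T-true Qy′)) ⟩
        filterᵇ Q (pre ++ y ∷ []) ++ y′ ∷ filterᵇ Q post      ∎
        where open ≡-Reasoning
      last-split≡y : last (filterᵇ Q (pre ++ y ∷ []) ++ y′ ∷ filterᵇ Q post) ≡ just y
      last-split≡y = trans (cong last (sym split-at-y′)) last≡y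
      after-y : y ∈ y′ ∷ filterᵇ Q post → R y y
      after-y (here y≡y′) = subst (R y) (sym y≡y′) y<y′
      after-y (there y∈post) = R-trans y<y′ (y′<post (proj₁ (∈-filter⁻ (T? ∘ Q) y∈post)))
    ... | false | false = ⊥-elim (R-irrefl (pre<y (proj₁ (∈-filter⁻ (T? ∘ Q) (last-∈ (filterᵇ Q pre) last≡pre)))))
      where
      last≡pre : last (filterᵇ Q pre) ≡ just y
      last≡pre = begin
        last (filterᵇ Q pre)                               ≡⟨ cong last (sym (++-identityʳ (filterᵇ Q pre))) ⟩
        last (filterᵇ Q pre ++ [])                         ≡⟨ cong (λ zs → last (filterᵇ Q pre ++ zs)) (sym (filterᵇ-none Q (y ∷ y′ ∷ post) none)) ⟩
        last (filterᵇ Q pre ++ filterᵇ Q (y ∷ y′ ∷ post))  ≡⟨ cong last (sym (filter-++ (T? ∘ Q) pre (y ∷ y′ ∷ post))) ⟩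
        last (filterᵇ Q L)                                 ≡⟨ last≡y ⟩
        just y                                             ∎
        where
        open ≡-Reasoning
        none : ∀ {z} → z ∈ y ∷ y′ ∷ post → Q z ≡ false
        none (here refl) = Qy
        none (there (here refl)) = Qy′
        none (there (there z∈post)) = Q-false-after-y′ Qy′ z∈post

-- xa, …, xd are the coordinates of the corners of a face with lower side [a,c]
-- (space flow si), upper side [b,d] (space flow so) and slopes p, p′ on its
-- edges (a,b), (c,d).
slope-from-face : ∀ (xa xb xc xd p p′ si so : ℤ) → xa +ℤ si ≡ xc → xb +ℤ so ≡ xd → xd ≡ xc +ℤ p′ →
  si +ℤ p′ ≡ p +ℤ so → xb ≡ xa +ℤ p
slope-from-face xa xb xc xd p p′ si so lower upper right conserve = begin
  xb                        ≡⟨ x≡x+y-y xb so ⟩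
  xb +ℤ so -ℤ so            ≡⟨ cong (_-ℤ so) (trans upper right) ⟩
  xc +ℤ p′ -ℤ so            ≡⟨ cong (λ x → x +ℤ p′ -ℤ so) (sym lower) ⟩
  xa +ℤ si +ℤ p′ -ℤ so      ≡⟨ reassoc xa si p′ so ⟩
  xa +ℤ (si +ℤ p′) -ℤ so    ≡⟨ cong (λ x → xa +ℤ x -ℤ so) conserve ⟩
  xa +ℤ (p +ℤ so) -ℤ so     ≡⟨ cancel xa p so ⟩
  xa +ℤ p                   ∎
  where
  open ≡-Reasoning
  x≡x+y-y : ∀ x y → x ≡ x +ℤ y -ℤ y
  x≡x+y-y = solve-∀
  reassoc : ∀ a b c d → a +ℤ b +ℤ c -ℤ d ≡ a +ℤ (b +ℤ c) -ℤ d
  reassoc = solve-∀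
  cancel : ∀ a b c → a +ℤ (b +ℤ c) -ℤ c ≡ a +ℤ b
  cancel = solve-∀

_<ₗₑₓ_ : ℕ × ℕ → ℕ × ℕ → Set
(a , b) <ₗₑₓ (c , d) = a < c ⊎ (a ≡ c × b < d)

<ₗₑₓ-irrefl : ∀ {k} → ¬ k <ₗₑₓ k
<ₗₑₓ-irrefl (inj₁ a<a) = <-irrefl refl a<a
<ₗₑₓ-irrefl (inj₂ (_ , b<b)) = <-irrefl refl b<b

<ₗₑₓ-trans : ∀ {k l n} → k <ₗₑₓ l → l <ₗₑₓ n → k <ₗₑₓ n
<ₗₑₓ-trans (inj₁ p) (inj₁ q) = inj₁ (<-trans p q)
<ₗₑₓ-trans (inj₁ p) (inj₂ (refl , _)) = inj₁ p
<ₗₑₓ-trans (inj₂ (refl , _)) (inj₁ q) = inj₁ q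
<ₗₑₓ-trans (inj₂ (refl , p)) (inj₂ (refl , q)) = inj₂ (refl , <-trans p q)

<ₗₑₓ⇒proj₁-≤ : ∀ {a b c d} → (a , b) <ₗₑₓ (c , d) → a ≤ c
<ₗₑₓ⇒proj₁-≤ (inj₁ a<c) = <⇒≤ a<c
<ₗₑₓ⇒proj₁-≤ (inj₂ (refl , _)) = ≤-refl

key : ∀ {m n} → Fin m × Fin n → ℕ × ℕ
key (a , b) = toℕ a , toℕ b

key-injective : ∀ {m n} {e f : Fin m × Fin n} → key e ≡ key f → e ≡ f
key-injective {e = a , b} {c , d} ab≡cd = cong₂ _,_ (toℕ-injective (cong proj₁ ab≡cd)) (toℕ-injective (cong proj₂ ab≡cd))

not-<ₗₑₓ-last : ∀ {m n} (e : Fin (suc m) × Fin (suc n)) → ¬ (m , n) <ₗₑₓ key e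
not-<ₗₑₓ-last (a , b) (inj₁ m<a) = <⇒≱ m<a (toℕ≤pred[n] a)
not-<ₗₑₓ-last (a , b) (inj₂ (_ , n<b)) = <⇒≱ n<b (toℕ≤pred[n] b)

module _ (G : LevelGraph) where

  lexLess-true⁻ : ∀ {A B} (e f : Fin A × Fin B) → lexLess G e f ≡ true → key e <ₗₑₓ key f
  lexLess-true⁻ (a , b) (c , d) h with suc (toℕ a) ≤ᵇ toℕ c in a<c
  ... | true = inj₁ (≤ᵇ-true⁻ a<c)
  ... | false with toℕ a ≡ᵇ toℕ c in a≡c | suc (toℕ b) ≤ᵇ toℕ d in b<d
  ... | true | true = inj₂ (≡ᵇ-true⁻ a≡c , ≤ᵇ-true⁻ b<d)

  lexLess-true : ∀ {A B} (e f : Fin A × Fin B) → key e <ₗₑₓ key f → lexLess G e f ≡ true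
  lexLess-true (a , b) (c , d) (inj₁ a<c) rewrite ≤ᵇ-true a<c = refl
  lexLess-true (a , b) (c , d) (inj₂ (a≡c , b<d))
    rewrite ≤ᵇ-false {suc (toℕ a)} {toℕ c} (≤-reflexive (cong suc (sym a≡c))) | ≡ᵇ-true a≡c | ≤ᵇ-true b<d = refl

  lexLess-false : ∀ {A B} (e f : Fin A × Fin B) → ¬ key e <ₗₑₓ key f → lexLess G e f ≡ false
  lexLess-false e f e≮f = ¬-not (e≮f ∘ lexLess-true⁻ e f)

module Dual (G : LevelGraph) (emb : IsEmbeddedWithBoundary G)
            (λ′ : ℕ) (φ : Arc G → ℕ) (circ : IsCirculation G λ′ φ) where
  open LevelGraph G
  open IsEmbeddedWithBoundary emb
  open IsCirculation circ

  Edge : Fin m → Set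
  Edge j = Fin (width G (inject₁ j)) × Fin (width G (fsuc j))

  _<ₑ_ : ∀ {j} → Edge j → Edge j → Set
  e <ₑ f = key e <ₗₑₓ key f

  rightmostEdge : (j : Fin m) → Edge j
  rightmostEdge j = lastOf G (inject₁ j) , lastOf G (fsuc j)

  edgesFrom : (j : Fin m) (a : Fin (width G (inject₁ j))) → List (Edge j)
  edgesFrom j a = map (a ,_) (filterᵇ (edge j a) (allFin _))

  ∈-edgesIn⁺ : ∀ j a b → edge j a b ≡ true → (a , b) ∈ edgesIn G j
  ∈-edgesIn⁺ j a b ab∈E = ∈-concat⁺′ (∈-map⁺ (a ,_) (∈-filter⁺ (T? ∘ edge j a) (∈-allFin b) (T-true ab∈E)))
                                     (∈-map⁺ (edgesFrom j) (∈-allFin a))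

  ∈-edgesFrom⁻ : ∀ j a {e} → e ∈ edgesFrom j a → proj₁ e ≡ a × edge j a (proj₂ e) ≡ true
  ∈-edgesFrom⁻ j a e∈ with ∈-map⁻ (a ,_) e∈
  ... | b , b∈ , refl = refl , Equivalence.to T-≡ (proj₂ (∈-filter⁻ (T? ∘ edge j a) b∈))

  ∈-edgesIn⁻ : ∀ j {e} → e ∈ edgesIn G j → edge j (proj₁ e) (proj₂ e) ≡ true
  ∈-edgesIn⁻ j e∈ with ∈-concat⁻′ (map (edgesFrom j) (allFin _)) e∈
  ... | _ , e∈es , es∈ with ∈-map⁻ (edgesFrom j) es∈
  ... | a , _ , refl with ∈-edgesFrom⁻ j a e∈es
  ... | refl , ab∈E = ab∈E

  edgesIn-sorted : ∀ j → AllPairs _<ₑ_ (edgesIn G j)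
  edgesIn-sorted j = AllPairs.concat⁺ (All.tabulate within) (AllPairs.map⁺ (AllPairs.tabulate⁺-< across))
    where
    within : ∀ {es} → es ∈ map (edgesFrom j) (allFin _) → AllPairs _<ₑ_ es
    within es∈ with ∈-map⁻ (edgesFrom j) es∈
    ... | a , _ , refl = AllPairs.map⁺ (AllPairs.filter⁺ (T? ∘ edge j a) (AllPairs.tabulate⁺-< (λ b<b′ → inj₂ (refl , b<b′))))
    across : ∀ {a a′} → toℕ a < toℕ a′ → All (λ e → All (e <ₑ_) (edgesFrom j a′)) (edgesFrom j a)
    across {a} {a′} a<a′ = All.tabulate λ e∈ → All.tabulate λ f∈ →
      sources (proj₁ (∈-edgesFrom⁻ j a e∈)) (proj₁ (∈-edgesFrom⁻ j a′ f∈))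
      where
      sources : ∀ {e f : Edge j} → proj₁ e ≡ a → proj₁ f ≡ a′ → e <ₑ f
      sources refl refl = inj₁ a<a′

  <ₑ⇒target≤ : ∀ j {e f : Edge j} → e ∈ edgesIn G j → f ∈ edgesIn G j → e <ₑ f → toℕ (proj₂ e) ≤ toℕ (proj₂ f)
  <ₑ⇒target≤ j {a , b} {c , d} e∈ f∈ (inj₁ a<c) = planar j a b c d (∈-edgesIn⁻ j e∈) (∈-edgesIn⁻ j f∈) a<c
  <ₑ⇒target≤ j e∈ f∈ (inj₂ (_ , b<d)) = <⇒≤ b<d

  -- dual G φ (ℓ , p) is coord ℓ (toℕ p) definitionally: dualH counts vertices from the right end of the level.
  coord : Fin (suc m) → ℕ → ℤ
  coord ℓ i = dualH G φ ℓ (pw ℓ ∸ i)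

  spaceArc-flow : ∀ ℓ (p : Fin (width G ℓ)) → spaceFlow G φ ℓ (toℕ p) ≡ φ (space ℓ p)
  spaceArc-flow ℓ p with toℕ p <? width G ℓ
  ... | yes p<w = cong (φ ∘ space ℓ) (fromℕ<-toℕ p p<w)
  ... | no p≮w = ⊥-elim (p≮w (toℕ<n p))

  coord-suc : ∀ ℓ i → i < pw ℓ → coord ℓ (suc i) ≡ coord ℓ i +ℤ + spaceFlow G φ ℓ i
  coord-suc ℓ i i<pw = sym (begin
    coord ℓ i +ℤ + spaceFlow G φ ℓ i
      ≡⟨ cong (λ k → dualH G φ ℓ k +ℤ + spaceFlow G φ ℓ i) (pw∸i≡suc[pw∸suc[i]]) ⟩
    dualH G φ ℓ (pw ℓ ∸ suc i) -ℤ + spaceFlow G φ ℓ (pw ℓ ∸ suc (pw ℓ ∸ suc i)) +ℤ + spaceFlow G φ ℓ i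
      ≡⟨ cong (λ k → dualH G φ ℓ (pw ℓ ∸ suc i) -ℤ + spaceFlow G φ ℓ k +ℤ + spaceFlow G φ ℓ i) pw∸suc[pw∸suc[i]]≡i ⟩
    dualH G φ ℓ (pw ℓ ∸ suc i) -ℤ + spaceFlow G φ ℓ i +ℤ + spaceFlow G φ ℓ i
      ≡⟨ [x-y]+y≡x _ _ ⟩
    coord ℓ (suc i) ∎)
    where
    open ≡-Reasoning
    pw∸i≡suc[pw∸suc[i]] : pw ℓ ∸ i ≡ suc (pw ℓ ∸ suc i)
    pw∸i≡suc[pw∸suc[i]] = +-∸-assoc 1 i<pw
    pw∸suc[pw∸suc[i]]≡i : pw ℓ ∸ suc (pw ℓ ∸ suc i) ≡ i
    pw∸suc[pw∸suc[i]]≡i = trans (cong (pw ℓ ∸_) (sym pw∸i≡suc[pw∸suc[i]])) (m∸[m∸n]≡n (<⇒≤ i<pw))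
    [x-y]+y≡x : ∀ x y → x -ℤ y +ℤ y ≡ x
    [x-y]+y≡x = solve-∀

  slopeArcs : Fin m → List (Arc G)
  slopeArcs j = map (λ e → slope j (proj₁ e) (proj₂ e)) (edgesIn G j)

  spaceIndices : (ℓ : Fin (suc m)) → List (Fin (width G ℓ))
  spaceIndices ℓ = filterᵇ (λ p → suc (toℕ p) ≤ᵇ pw ℓ) (allFin (width G ℓ))

  spaceArcs : Fin (suc m) → List (Arc G)
  spaceArcs ℓ = map (space ℓ) (spaceIndices ℓ)

  spaceArc∈arcs : ∀ ℓ (p : Fin (width G ℓ)) → toℕ p < pw ℓ → space ℓ p ∈ arcs G
  spaceArc∈arcs ℓ p p<pw = ∈-++⁺ʳ (concatMap slopeArcs (allFin m)) (∈-++⁺ˡ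
    (∈-concat⁺′ (∈-map⁺ (space ℓ) (∈-filter⁺ (λ p → T? (suc (toℕ p) ≤ᵇ pw ℓ)) (∈-allFin p) (≤⇒≤ᵇ p<pw)))
                (∈-map⁺ spaceArcs (∈-allFin ℓ))))

  slopeArc∈arcs : ∀ j a b → edge j a b ≡ true → slope j a b ∈ arcs G
  slopeArc∈arcs j a b ab∈E =
    ∈-++⁺ˡ (∈-concat⁺′ (∈-map⁺ (λ e → slope j (proj₁ e) (proj₂ e)) (∈-edgesIn⁺ j a b ab∈E))
                       (∈-map⁺ slopeArcs (∈-allFin j)))

  spaceFlow-positive : ∀ ℓ i → i < pw ℓ → 1 ≤ spaceFlow G φ ℓ i
  spaceFlow-positive ℓ i i<pw = subst (1 ≤_) (sym flow≡) (lower (space ℓ p) (spaceArc∈arcs ℓ p (subst (_< pw ℓ) (sym p≡i) i<pw)))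
    where
    i<w : i < width G ℓ
    i<w = m<n⇒m<1+n i<pw
    p : Fin (width G ℓ)
    p = fromℕ< i<w
    p≡i : toℕ p ≡ i
    p≡i = toℕ-fromℕ< i<w
    flow≡ : spaceFlow G φ ℓ i ≡ φ (space ℓ p)
    flow≡ = trans (cong (spaceFlow G φ ℓ) (sym p≡i)) (spaceArc-flow ℓ p)

  coord-<-suc : ∀ ℓ i → i < pw ℓ → coord ℓ i <ℤ coord ℓ (suc i)
  coord-<-suc ℓ i i<pw = subst (coord ℓ i <ℤ_) (sym (coord-suc ℓ i i<pw))
    (subst (_<ℤ coord ℓ i +ℤ + spaceFlow G φ ℓ i) (ℤ.+-identityʳ (coord ℓ i))
      (ℤ.+-monoʳ-< (coord ℓ i) (+<+ (spaceFlow-positive ℓ i i<pw))))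

  coord-strictMono : ∀ ℓ {i n} → i < n → n ≤ pw ℓ → coord ℓ i <ℤ coord ℓ n
  coord-strictMono ℓ {i} {suc n} (s≤s i≤n) n<pw with m≤n⇒m<n∨m≡n i≤n
  ... | inj₁ i<n = ℤ.<-trans (coord-strictMono ℓ i<n (<⇒≤ n<pw)) (coord-<-suc ℓ n n<pw)
  ... | inj₂ refl = coord-<-suc ℓ i n<pw

  coord-mono : ∀ ℓ {i n} → i ≤ n → n ≤ pw ℓ → coord ℓ i ≤ℤ coord ℓ n
  coord-mono ℓ i≤n n≤pw with m≤n⇒m<n∨m≡n i≤n
  ... | inj₁ i<n = ℤ.<⇒≤ (coord-strictMono ℓ i<n n≤pw)
  ... | inj₂ refl = ℤ.≤-refl

  between? : ℕ → ℕ → ℕ → Bool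
  between? lo hi i = (lo ≤ᵇ i) ∧ (suc i ≤ᵇ hi)

  spaceFlowBetween : ∀ ℓ → ℕ → ℕ → Fin (width G ℓ) → ℕ
  spaceFlowBetween ℓ lo hi p = if between? lo hi (toℕ p) then φ (space ℓ p) else 0

  spaceFlowAt : ∀ ℓ → ℕ → Fin (width G ℓ) → ℕ
  spaceFlowAt ℓ h p = if toℕ p ≡ᵇ h then φ (space ℓ p) else 0

  spaceFlowBetween-empty : ∀ ℓ lo p → spaceFlowBetween ℓ lo lo p ≡ 0
  spaceFlowBetween-empty ℓ lo p with lo ≤ᵇ toℕ p in lo≤p
  ... | false = refl
  ... | true rewrite ≤ᵇ-false {suc (toℕ p)} {lo} (s≤s (≤ᵇ-true⁻ lo≤p)) = refl

  spaceFlowBetween-suc : ∀ ℓ lo h p → lo ≤ h → spaceFlowBetween ℓ lo (suc h) p ≡ spaceFlowBetween ℓ lo h p + spaceFlowAt ℓ h p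
  spaceFlowBetween-suc ℓ lo h p lo≤h with <-cmp (toℕ p) h
  ... | tri< p<h _ _ rewrite ≤ᵇ-true {suc (toℕ p)} {suc h} (s≤s (<⇒≤ p<h)) | ≤ᵇ-true p<h | ≡ᵇ-false (<⇒≢ p<h)
                           | ∧-identityʳ (lo ≤ᵇ toℕ p) = sym (+-identityʳ _)
  ... | tri≈ _ refl _ rewrite ≤ᵇ-true lo≤h | ≤ᵇ-true {suc h} {suc h} ≤-refl | ≤ᵇ-false {suc h} {h} ≤-refl
                            | ≡ᵇ-true {h} refl = refl
  ... | tri> _ _ h<p rewrite ≤ᵇ-false {suc (toℕ p)} {suc h} (s≤s h<p) | ≤ᵇ-false {suc (toℕ p)} {h} (<-trans h<p (n<1+n _))
                           | ≡ᵇ-false (≢-sym (<⇒≢ h<p)) | ∧-zeroʳ (lo ≤ᵇ toℕ p) = refl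

  sum-spaceFlowAt : ∀ ℓ h → h < width G ℓ → sum (map (spaceFlowAt ℓ h) (allFin (width G ℓ))) ≡ spaceFlow G φ ℓ h
  sum-spaceFlowAt ℓ h h<w = begin
    sum (map (spaceFlowAt ℓ h) (allFin (width G ℓ)))  ≡⟨ sum-allFin-point (spaceFlowAt ℓ h) p elsewhere ⟩
    spaceFlowAt ℓ h p                                  ≡⟨ if-true (≡ᵇ-true (toℕ-fromℕ< h<w)) ⟩
    φ (space ℓ p)                                      ≡⟨ sym (spaceArc-flow ℓ p) ⟩
    spaceFlow G φ ℓ (toℕ p)                            ≡⟨ cong (spaceFlow G φ ℓ) (toℕ-fromℕ< h<w) ⟩
    spaceFlow G φ ℓ h                                  ∎
    where
    open ≡-Reasoning
    p : Fin (width G ℓ)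
    p = fromℕ< h<w
    elsewhere : ∀ k → k ≢ p → spaceFlowAt ℓ h k ≡ 0
    elsewhere k k≢p = if-false (≡ᵇ-false (λ k≡h → k≢p (toℕ-injective (trans k≡h (sym (toℕ-fromℕ< h<w))))))

  coord-telescope : ∀ ℓ lo k → lo + k ≤ pw ℓ →
    coord ℓ lo +ℤ + sum (map (spaceFlowBetween ℓ lo (lo + k)) (allFin (width G ℓ))) ≡ coord ℓ (lo + k)
  coord-telescope ℓ lo zero _ rewrite +-identityʳ lo
    | sum-map-zero (spaceFlowBetween ℓ lo lo) (allFin (width G ℓ)) (λ {p} _ → spaceFlowBetween-empty ℓ lo p) = ℤ.+-identityʳ (coord ℓ lo)
  coord-telescope ℓ lo (suc k) lo+k<pw rewrite +-suc lo k = begin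
    coord ℓ lo +ℤ + sum (map (spaceFlowBetween ℓ lo (suc h)) Ps)
      ≡⟨ cong (λ n → coord ℓ lo +ℤ + n) sum-suc ⟩
    coord ℓ lo +ℤ + (sum (map (spaceFlowBetween ℓ lo h) Ps) + spaceFlow G φ ℓ h)
      ≡⟨ cong (coord ℓ lo +ℤ_) (ℤ.pos-+ (sum (map (spaceFlowBetween ℓ lo h) Ps)) (spaceFlow G φ ℓ h)) ⟩
    coord ℓ lo +ℤ (+ sum (map (spaceFlowBetween ℓ lo h) Ps) +ℤ + spaceFlow G φ ℓ h)
      ≡⟨ sym (ℤ.+-assoc (coord ℓ lo) _ _) ⟩
    coord ℓ lo +ℤ + sum (map (spaceFlowBetween ℓ lo h) Ps) +ℤ + spaceFlow G φ ℓ h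
      ≡⟨ cong (_+ℤ + spaceFlow G φ ℓ h) (coord-telescope ℓ lo k (<⇒≤ lo+k<pw)) ⟩
    coord ℓ h +ℤ + spaceFlow G φ ℓ h
      ≡⟨ sym (coord-suc ℓ h lo+k<pw) ⟩
    coord ℓ (suc h) ∎
    where
    open ≡-Reasoning
    h : ℕ
    h = lo + k
    Ps : List (Fin (width G ℓ))
    Ps = allFin (width G ℓ)
    sum-suc : sum (map (spaceFlowBetween ℓ lo (suc h)) Ps) ≡ sum (map (spaceFlowBetween ℓ lo h) Ps) + spaceFlow G φ ℓ h
    sum-suc = begin
      sum (map (spaceFlowBetween ℓ lo (suc h)) Ps)
        ≡⟨ cong sum (map-cong (λ p → spaceFlowBetween-suc ℓ lo h p (m≤m+n lo k)) Ps) ⟩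
      sum (map (λ p → spaceFlowBetween ℓ lo h p + spaceFlowAt ℓ h p) Ps)
        ≡⟨ sum-map-+ (spaceFlowBetween ℓ lo h) (spaceFlowAt ℓ h) Ps ⟩
      sum (map (spaceFlowBetween ℓ lo h) Ps) + sum (map (spaceFlowAt ℓ h) Ps)
        ≡⟨ cong (_+_ (sum (map (spaceFlowBetween ℓ lo h) Ps))) (sum-spaceFlowAt ℓ h (m<n⇒m<1+n lo+k<pw)) ⟩
      sum (map (spaceFlowBetween ℓ lo h) Ps) + spaceFlow G φ ℓ h ∎

  coord-spaceSum : ∀ ℓ {lo hi} → lo ≤ hi → hi ≤ pw ℓ → (onFace : Fin (width G ℓ) → Bool) →
    (∀ p → onFace p ≡ between? lo hi (toℕ p)) →
    coord ℓ lo +ℤ + sum (map (λ p → if onFace p then φ (space ℓ p) else 0) (spaceIndices ℓ)) ≡ coord ℓ hi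
  coord-spaceSum ℓ {lo} {hi} lo≤hi hi≤pw onFace onFace≡ = begin
    coord ℓ lo +ℤ + sum (map onFaceFlow (spaceIndices ℓ))
      ≡⟨ cong (λ n → coord ℓ lo +ℤ + n) onFace-between ⟩
    coord ℓ lo +ℤ + sum (map (spaceFlowBetween ℓ lo hi) (allFin (width G ℓ)))
      ≡⟨ cong (λ n → coord ℓ lo +ℤ + sum (map (spaceFlowBetween ℓ lo n) (allFin (width G ℓ)))) (sym lo+[hi∸lo]≡hi) ⟩
    coord ℓ lo +ℤ + sum (map (spaceFlowBetween ℓ lo (lo + (hi ∸ lo))) (allFin (width G ℓ)))
      ≡⟨ coord-telescope ℓ lo (hi ∸ lo) (subst (_≤ pw ℓ) (sym lo+[hi∸lo]≡hi) hi≤pw) ⟩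
    coord ℓ (lo + (hi ∸ lo))
      ≡⟨ cong (coord ℓ) lo+[hi∸lo]≡hi ⟩
    coord ℓ hi ∎
    where
    open ≡-Reasoning
    lo+[hi∸lo]≡hi : lo + (hi ∸ lo) ≡ hi
    lo+[hi∸lo]≡hi = m+[n∸m]≡n lo≤hi
    onFaceFlow : Fin (width G ℓ) → ℕ
    onFaceFlow p = if onFace p then φ (space ℓ p) else 0
    pointwise : ∀ p → (if suc (toℕ p) ≤ᵇ pw ℓ then onFaceFlow p else 0) ≡ spaceFlowBetween ℓ lo hi p
    pointwise p rewrite onFace≡ p with suc (toℕ p) ≤ᵇ pw ℓ in p<pw
    ... | true = refl
    ... | false rewrite ≤ᵇ-false {suc (toℕ p)} {hi} (s≤s (≤-trans hi≤pw (≤-pred (≤ᵇ-false⁻ p<pw))))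
                      | ∧-zeroʳ (lo ≤ᵇ toℕ p) = refl
    onFace-between : sum (map onFaceFlow (spaceIndices ℓ)) ≡ sum (map (spaceFlowBetween ℓ lo hi) (allFin (width G ℓ)))
    onFace-between = trans (sum-map-filterᵇ (λ p → suc (toℕ p) ≤ᵇ pw ℓ) onFaceFlow (allFin (width G ℓ)))
                           (cong sum (map-cong pointwise (allFin (width G ℓ))))

  faceOf : (j : Fin m) → Edge j → Node G
  faceOf j e = face j (proj₁ e) (proj₂ e)

  NotAFace : Node G → Set
  NotAFace d = ∀ {j a b} → eqNode G d (face j a b) ≡ false

  eqNode-face⁻ : ∀ {j j′ a b a′ b′} → eqNode G (face j a b) (face j′ a′ b′) ≡ true →
    toℕ j ≡ toℕ j′ × key (a , b) ≡ key (a′ , b′)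
  eqNode-face⁻ {j} {j′} {a} {b} {a′} {b′} h
    with toℕ j ≡ᵇ toℕ j′ in j≡ | toℕ a ≡ᵇ toℕ a′ in a≡ | toℕ b ≡ᵇ toℕ b′ in b≡
  ... | true | true | true = ≡ᵇ-true⁻ j≡ , cong₂ _,_ (≡ᵇ-true⁻ a≡) (≡ᵇ-true⁻ b≡)

  eqNode-faceOf-refl : ∀ j (e : Edge j) → eqNode G (faceOf j e) (faceOf j e) ≡ true
  eqNode-faceOf-refl j (a , b) rewrite ≡ᵇ-true {toℕ j} refl | ≡ᵇ-true {toℕ a} refl | ≡ᵇ-true {toℕ b} refl = refl

  maybe-faceOf⁻ : ∀ {d} → NotAFace d → ∀ {j} (M : Maybe (Edge j)) {j′ a b} →
    eqNode G (maybe (faceOf j) d M) (face j′ a b) ≡ true →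
    toℕ j ≡ toℕ j′ × Σ (Edge j) λ w → M ≡ just w × key w ≡ key (a , b)
  maybe-faceOf⁻ d≢face (just w) h = let (j≡ , w≡) = eqNode-face⁻ h in j≡ , w , refl , w≡
  maybe-faceOf⁻ d≢face nothing h = ⊥-elim (true≢false (trans (sym h) d≢face))

  rightOf-face⁻ : ∀ {j′} (e : Edge j′) {j a b} → eqNode G (rightOf G j′ (proj₁ e) (proj₂ e)) (face j a b) ≡ true →
    toℕ j′ ≡ toℕ j × key e ≡ key (a , b)
  rightOf-face⁻ {j′} (a′ , b′) h with isLastEdge G j′ a′ b′
  ... | false = eqNode-face⁻ h

  first-candidate-face : ∀ {d} → NotAFace d → (g : Fin m → Maybe (Node G)) → ∀ {j a b} →
    eqNode G (fromMaybe d (head (mapMaybe g (allFin m)))) (face j a b) ≡ true →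
    Σ (Fin m) λ i → Σ (Node G) λ n → g i ≡ just n × eqNode G n (face j a b) ≡ true
  first-candidate-face d≢face g h with head (mapMaybe g (allFin m)) in first
  ... | nothing = ⊥-elim (true≢false (trans (sym h) d≢face))
  ... | just n = let (i , gi) = head-mapMaybe-just g (allFin m) first in i , n , gi , h

  faceWhere-face⁻ : ∀ i P {n j a b} → faceWhere G i P ≡ just n → eqNode G n (face j a b) ≡ true → toℕ i ≡ toℕ j
  faceWhere-face⁻ i P fw h with last (filterᵇ P (edgesIn G i))
  faceWhere-face⁻ i P refl h | just (a , b) = proj₁ (eqNode-face⁻ {a = a} {b = b} h)

  sourceAtMost targetAtMost : ∀ {j} → ℕ → Edge j → Bool
  sourceAtMost k e = toℕ (proj₁ e) ≤ᵇ k
  targetAtMost k e = toℕ (proj₂ e) ≤ᵇ k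

  aboveCandidate : (ℓ : Fin (suc m)) → Fin (width G ℓ) → Fin m → Maybe (Node G)
  aboveCandidate ℓ p i = if toℕ i ≡ᵇ toℕ ℓ then faceWhere G i (sourceAtMost (toℕ p)) else nothing

  belowCandidate : (ℓ : Fin (suc m)) → Fin (width G ℓ) → Fin m → Maybe (Node G)
  belowCandidate ℓ q i = if suc (toℕ i) ≡ᵇ toℕ ℓ then faceWhere G i (targetAtMost (toℕ q)) else nothing

  above-face⇒level : ∀ ℓ p {j a b} → eqNode G (above G ℓ p) (face j a b) ≡ true → toℕ ℓ ≡ toℕ j
  above-face⇒level ℓ p h with first-candidate-face refl (aboveCandidate ℓ p) h
  ... | i , n , gi , n≡face with if-nothing⁻ gi
  ... | i≡ℓ , fw = trans (sym (≡ᵇ-true⁻ i≡ℓ)) (faceWhere-face⁻ i _ fw n≡face)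

  below-face⇒level : ∀ ℓ q {j a b} → eqNode G (below G ℓ q) (face j a b) ≡ true → toℕ ℓ ≡ suc (toℕ j)
  below-face⇒level ℓ q h with first-candidate-face refl (belowCandidate ℓ q) h
  ... | i , n , gi , n≡face with if-nothing⁻ gi
  ... | i+1≡ℓ , fw = trans (sym (≡ᵇ-true⁻ i+1≡ℓ)) (cong suc (faceWhere-face⁻ i _ fw n≡face))

  above-strip : ∀ j (p : Fin (width G (inject₁ j))) →
    above G (inject₁ j) p ≡ maybe (faceOf j) t (last (filterᵇ (sourceAtMost (toℕ p)) (edgesIn G j)))
  above-strip j p = trans (cong (fromMaybe t) (trans (head-mapMaybe-allFin-point (aboveCandidate (inject₁ j) p) j elsewhere)
                                                     (if-true (≡ᵇ-true (sym (toℕ-inject₁ j))))))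
                          (fromMaybe-map (faceOf j) t (last (filterᵇ (sourceAtMost (toℕ p)) (edgesIn G j))))
    where
    elsewhere : ∀ i → i ≢ j → aboveCandidate (inject₁ j) p i ≡ nothing
    elsewhere i i≢j = if-false (≡ᵇ-false (λ i≡j → i≢j (toℕ-injective (trans i≡j (toℕ-inject₁ j)))))

  below-strip : ∀ j (q : Fin (width G (fsuc j))) →
    below G (fsuc j) q ≡ maybe (faceOf j) s (last (filterᵇ (targetAtMost (toℕ q)) (edgesIn G j)))
  below-strip j q = trans (cong (fromMaybe s) (trans (head-mapMaybe-allFin-point (belowCandidate (fsuc j) q) j elsewhere)
                                                     (if-true (≡ᵇ-true {suc (toℕ j)} refl))))
                          (fromMaybe-map (faceOf j) s (last (filterᵇ (targetAtMost (toℕ q)) (edgesIn G j))))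
    where
    elsewhere : ∀ i → i ≢ j → belowCandidate (fsuc j) q i ≡ nothing
    elsewhere i i≢j = if-false (≡ᵇ-false (λ i+1≡j+1 → i≢j (toℕ-injective (suc-injective i+1≡j+1))))

  flowIf : (Arc G → Bool) → Arc G → ℕ
  flowIf P α = if P α then φ α else 0

  sum-flowIf-arcs : (P : Arc G → Bool) (j : Fin m) (ℓ : Fin (suc m)) →
    (∀ {j′} a b → P (slope j′ a b) ≡ true → toℕ j′ ≡ toℕ j) →
    (∀ {ℓ′} p → P (space ℓ′ p) ≡ true → toℕ ℓ′ ≡ toℕ ℓ) → P ts ≡ false →
    sum (map φ (filterᵇ P (arcs G))) ≡ sum (map (flowIf P) (slopeArcs j)) + sum (map (flowIf P) (spaceArcs ℓ))
  sum-flowIf-arcs P j ℓ slope-at space-at ts∉P = begin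
    sum (map φ (filterᵇ P (arcs G)))
      ≡⟨ sum-map-filterᵇ P φ (arcs G) ⟩
    sum (map (flowIf P) (concatMap slopeArcs (allFin m) ++ concatMap spaceArcs (allFin (suc m)) ++ ts ∷ []))
      ≡⟨ sum-map-++ (flowIf P) (concatMap slopeArcs (allFin m)) _ ⟩
    sum (map (flowIf P) (concatMap slopeArcs (allFin m))) + sum (map (flowIf P) (concatMap spaceArcs (allFin (suc m)) ++ ts ∷ []))
      ≡⟨ cong₂ _+_ slopes (trans (sum-map-++ (flowIf P) (concatMap spaceArcs (allFin (suc m))) (ts ∷ []))
                                 (cong₂ _+_ spaces ts-part)) ⟩
    sum (map (flowIf P) (slopeArcs j)) + (sum (map (flowIf P) (spaceArcs ℓ)) + 0)
      ≡⟨ cong (_+_ (sum (map (flowIf P) (slopeArcs j)))) (+-identityʳ _) ⟩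
    sum (map (flowIf P) (slopeArcs j)) + sum (map (flowIf P) (spaceArcs ℓ)) ∎
    where
    open ≡-Reasoning
    ts-part : sum (map (flowIf P) (ts ∷ [])) ≡ 0
    ts-part = cong (_+ 0) (if-false ts∉P)
    slopes : sum (map (flowIf P) (concatMap slopeArcs (allFin m))) ≡ sum (map (flowIf P) (slopeArcs j))
    slopes = trans (sum-map-concatMap (flowIf P) slopeArcs (allFin m)) (sum-allFin-point _ j λ j′ j′≢j →
      trans (sum-map-∘ (flowIf P) _ (edgesIn G j′)) (sum-map-zero _ (edgesIn G j′) λ {(a , b)} _ →
        if-false (¬-not (λ α∈P → j′≢j (toℕ-injective (slope-at a b α∈P))))))
    spaces : sum (map (flowIf P) (concatMap spaceArcs (allFin (suc m)))) ≡ sum (map (flowIf P) (spaceArcs ℓ))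
    spaces = trans (sum-map-concatMap (flowIf P) spaceArcs (allFin (suc m))) (sum-allFin-point _ ℓ λ ℓ′ ℓ′≢ℓ →
      trans (sum-map-∘ (flowIf P) (space ℓ′) (spaceIndices ℓ′)) (sum-map-zero _ (spaceIndices ℓ′) λ {p} _ →
        if-false (¬-not (λ α∈P → ℓ′≢ℓ (toℕ-injective (space-at p α∈P))))))

  SlopeEquation : (j : Fin m) → Edge j → Set
  SlopeEquation j e = coord (fsuc j) (toℕ (proj₂ e)) ≡ coord (inject₁ j) (toℕ (proj₁ e)) +ℤ + φ (slope j (proj₁ e) (proj₂ e))

  module BetweenEdges (j : Fin m) (pre : List (Edge j)) (y y′ : Edge j) (post : List (Edge j))
                      (edgesIn≡ : edgesIn G j ≡ pre ++ y ∷ y′ ∷ post) where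
    open SortedSplit {R = _<ₑ_} <ₗₑₓ-trans <ₗₑₓ-irrefl pre y y′ post (subst (AllPairs _<ₑ_) edgesIn≡ (edgesIn-sorted j))

    v : Node G
    v = faceOf j y

    ∈-edgesIn : ∀ {z} → z ∈ L → z ∈ edgesIn G j
    ∈-edgesIn = subst (_ ∈_) (sym edgesIn≡)

    y-not-rightmost : isLastEdge G j (proj₁ y) (proj₂ y) ≡ false
    y-not-rightmost = ¬-not λ isLast → not-<ₗₑₓ-last y′ (subst (_<ₗₑₓ key y′) (rightmost-key isLast) y<y′)
      where
      rightmost-key : isLastEdge G j (proj₁ y) (proj₂ y) ≡ true → key y ≡ (pw (inject₁ j) , pw (fsuc j))
      rightmost-key isLast = let (a≡ , b≡) = ∧-true⁻ isLast in cong₂ _,_ (≡ᵇ-true⁻ a≡) (≡ᵇ-true⁻ b≡)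

    v∈nodes : v ∈ nodes G
    v∈nodes = there (there (∈-concat⁺′
      (∈-map⁺ (faceOf j) (∈-filter⁺ (λ e → T? (not (isLastEdge G j (proj₁ e) (proj₂ e)))) (∈-edgesIn ∈-y)
                                    (T-true (cong not y-not-rightmost))))
      (∈-map⁺ _ (∈-allFin j))))

    DownClosed : (Edge j → Bool) → Set
    DownClosed Q = ∀ {u w} → u ∈ L → w ∈ L → u <ₑ w → Q w ≡ true → Q u ≡ true

    -- Defs names every region of strip j as the face of the last edge with some
    -- down-closed property Q; that region is v exactly when Q holds at y and fails at y′.
    lastFace≡v : ∀ {d} → NotAFace d → (Q : Edge j → Bool) → DownClosed Q →
      eqNode G (maybe (faceOf j) d (last (filterᵇ Q (edgesIn G j)))) v ≡ Q y ∧ not (Q y′)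
    lastFace≡v {d} d≢face Q Q-down rewrite edgesIn≡ = ⇔→≡ (mk⇔ to from)
      where
      to : eqNode G (maybe (faceOf j) d (last (filterᵇ Q L))) v ≡ true → Q y ∧ not (Q y′) ≡ true
      to h with maybe-faceOf⁻ d≢face (last (filterᵇ Q L)) h
      ... | _ , w , last≡w , w≡y with key-injective {e = w} {f = y} w≡y
      ... | refl with last-filterᵇ⁻ Q Q-down last≡w
      ... | Qy , Qy′ rewrite Qy | Qy′ = refl
      from : Q y ∧ not (Q y′) ≡ true → eqNode G (maybe (faceOf j) d (last (filterᵇ Q L))) v ≡ true
      from h with ∧-true⁻ h
      ... | Qy , ¬Qy′ rewrite last-filterᵇ Q Q-down Qy (not-injective {Q y′} {false} ¬Qy′) = eqNode-faceOf-refl j y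

    InV OutV : Arc G → Bool
    InV α = eqNode G (head' G α) v
    OutV α = eqNode G (tail G α) v

    φ-slope : Edge j → ℕ
    φ-slope e = φ (slope j (proj₁ e) (proj₂ e))

    inSlope : Edge j → ℕ
    inSlope z = flowIf InV (slope j (proj₁ z) (proj₂ z))

    inSlope≡ : ∀ z → inSlope z ≡ (if lexLess G y z ∧ not (lexLess G y′ z) then φ-slope z else 0)
    inSlope≡ z = cong (if_then φ-slope z else 0) (lastFace≡v refl (λ e → lexLess G e z) down)
      where
      down : DownClosed (λ e → lexLess G e z)
      down {u} {w} _ _ u<w w<z = lexLess-true G u z (<ₗₑₓ-trans u<w (lexLess-true⁻ G w z w<z))

    inSlope-left : ∀ z → ¬ y <ₑ z → inSlope z ≡ 0
    inSlope-left z y≮z = trans (inSlope≡ z) (if-false (cong (_∧ _) (lexLess-false G y z y≮z)))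

    inSlope-right : ∀ z → y′ <ₑ z → inSlope z ≡ 0
    inSlope-right z y′<z = trans (inSlope≡ z)
      (if-false (trans (cong (λ b → lexLess G y z ∧ not b) (lexLess-true G y′ z y′<z)) (∧-zeroʳ _)))

    inSlopes : sum (map (flowIf InV) (slopeArcs j)) ≡ φ-slope y′
    inSlopes = begin
      sum (map (flowIf InV) (slopeArcs j)) ≡⟨ sum-map-∘ (flowIf InV) _ (edgesIn G j) ⟩
      sum (map inSlope (edgesIn G j))      ≡⟨ cong (sum ∘ map inSlope) edgesIn≡ ⟩
      sum (map inSlope L)                   ≡⟨ sum-map-pair inSlope pre y y′ post
                                                 (λ {z} z∈ → inSlope-left z (λ y<z → <ₗₑₓ-irrefl (<ₗₑₓ-trans (pre<y z∈) y<z)))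
                                                 (λ {z} z∈ → inSlope-right z (y′<post z∈)) ⟩
      inSlope y + inSlope y′                ≡⟨ cong₂ _+_ (inSlope-left y <ₗₑₓ-irrefl) (trans (inSlope≡ y′) (if-true at-y′)) ⟩
      φ-slope y′                            ∎
      where
      open ≡-Reasoning
      at-y′ : lexLess G y y′ ∧ not (lexLess G y′ y′) ≡ true
      at-y′ = cong₂ _∧_ (lexLess-true G y y′ y<y′) (cong not (lexLess-false G y′ y′ <ₗₑₓ-irrefl))

    outSlope : Edge j → ℕ
    outSlope z = flowIf OutV (slope j (proj₁ z) (proj₂ z))

    outSlope-off : ∀ z → key z ≢ key y → outSlope z ≡ 0
    outSlope-off z z≢y = if-false (¬-not (λ h → z≢y (proj₂ (rightOf-face⁻ z h))))

    outSlopes : sum (map (flowIf OutV) (slopeArcs j)) ≡ φ-slope y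
    outSlopes = begin
      sum (map (flowIf OutV) (slopeArcs j)) ≡⟨ sum-map-∘ (flowIf OutV) _ (edgesIn G j) ⟩
      sum (map outSlope (edgesIn G j))      ≡⟨ cong (sum ∘ map outSlope) edgesIn≡ ⟩
      sum (map outSlope L)                   ≡⟨ sum-map-pair outSlope pre y y′ post
                                                  (λ {z} z∈ → outSlope-off z (λ z≡y → <ₗₑₓ-irrefl (subst (_<ₗₑₓ key y) z≡y (pre<y z∈))))
                                                  (λ {z} z∈ → outSlope-off z (λ z≡y → <ₗₑₓ-irrefl (subst (key y <ₗₑₓ_) z≡y
                                                                                   (<ₗₑₓ-trans y<y′ (y′<post z∈))))) ⟩
      outSlope y + outSlope y′               ≡⟨ cong₂ _+_ (if-true at-y) (outSlope-off y′ (λ y′≡y → <ₗₑₓ-irrefl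
                                                                                   (subst (key y <ₗₑₓ_) y′≡y y<y′))) ⟩
      φ-slope y + 0                          ≡⟨ +-identityʳ _ ⟩
      φ-slope y                              ∎
      where
      open ≡-Reasoning
      at-y : OutV (slope j (proj₁ y) (proj₂ y)) ≡ true
      at-y = trans (cong (λ n → eqNode G n v) (if-false y-not-rightmost)) (eqNode-faceOf-refl j y)

    a b c d : ℕ
    a = toℕ (proj₁ y)
    b = toℕ (proj₂ y)
    c = toℕ (proj₁ y′)
    d = toℕ (proj₂ y′)

    inSpaces : coord (inject₁ j) a +ℤ + sum (map (flowIf InV) (spaceArcs (inject₁ j))) ≡ coord (inject₁ j) c
    inSpaces = trans (cong (λ n → coord (inject₁ j) a +ℤ + n)
                           (sum-map-∘ (flowIf InV) (space (inject₁ j)) (spaceIndices (inject₁ j))))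
                     (coord-spaceSum (inject₁ j) (<ₗₑₓ⇒proj₁-≤ y<y′) (toℕ≤pred[n] (proj₁ y′)) _ above≡v)
      where
      down : ∀ k → DownClosed (sourceAtMost k)
      down k _ _ u<w w≤k = ≤ᵇ-true (≤-trans (<ₗₑₓ⇒proj₁-≤ u<w) (≤ᵇ-true⁻ w≤k))
      above≡v : ∀ p → eqNode G (above G (inject₁ j) p) v ≡ between? a c (toℕ p)
      above≡v p = begin
        eqNode G (above G (inject₁ j) p) v
          ≡⟨ cong (λ n → eqNode G n v) (above-strip j p) ⟩
        eqNode G (maybe (faceOf j) t (last (filterᵇ (sourceAtMost (toℕ p)) (edgesIn G j)))) v
          ≡⟨ lastFace≡v refl (sourceAtMost (toℕ p)) (down (toℕ p)) ⟩
        (a ≤ᵇ toℕ p) ∧ not (c ≤ᵇ toℕ p)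
          ≡⟨ cong ((a ≤ᵇ toℕ p) ∧_) (not-≤ᵇ c (toℕ p)) ⟩
        between? a c (toℕ p) ∎
        where open ≡-Reasoning

    outSpaces : coord (fsuc j) b +ℤ + sum (map (flowIf OutV) (spaceArcs (fsuc j))) ≡ coord (fsuc j) d
    outSpaces = trans (cong (λ n → coord (fsuc j) b +ℤ + n)
                            (sum-map-∘ (flowIf OutV) (space (fsuc j)) (spaceIndices (fsuc j))))
                      (coord-spaceSum (fsuc j) (<ₑ⇒target≤ j (∈-edgesIn ∈-y) (∈-edgesIn ∈-y′) y<y′)
                                      (toℕ≤pred[n] (proj₂ y′)) _ below≡v)
      where
      down : ∀ k → DownClosed (targetAtMost k)
      down k u∈ w∈ u<w w≤k = ≤ᵇ-true (≤-trans (<ₑ⇒target≤ j (∈-edgesIn u∈) (∈-edgesIn w∈) u<w) (≤ᵇ-true⁻ w≤k))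
      below≡v : ∀ q → eqNode G (below G (fsuc j) q) v ≡ between? b d (toℕ q)
      below≡v q = begin
        eqNode G (below G (fsuc j) q) v
          ≡⟨ cong (λ n → eqNode G n v) (below-strip j q) ⟩
        eqNode G (maybe (faceOf j) s (last (filterᵇ (targetAtMost (toℕ q)) (edgesIn G j)))) v
          ≡⟨ lastFace≡v refl (targetAtMost (toℕ q)) (down (toℕ q)) ⟩
        (b ≤ᵇ toℕ q) ∧ not (d ≤ᵇ toℕ q)
          ≡⟨ cong ((b ≤ᵇ toℕ q) ∧_) (not-≤ᵇ d (toℕ q)) ⟩
        between? b d (toℕ q) ∎
        where open ≡-Reasoning

    inflow≡ : inflow G φ v ≡ sum (map (flowIf InV) (slopeArcs j)) + sum (map (flowIf InV) (spaceArcs (inject₁ j)))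
    inflow≡ = sum-flowIf-arcs InV j (inject₁ j)
                (λ {j′} a′ b′ h → proj₁ (maybe-faceOf⁻ {t} refl (last (filterᵇ (λ e → lexLess G e (a′ , b′)) (edgesIn G j′)))
                                                       h))
                (λ p h → trans (above-face⇒level _ p h) (sym (toℕ-inject₁ j))) refl

    outflow≡ : outflow G φ v ≡ sum (map (flowIf OutV) (slopeArcs j)) + sum (map (flowIf OutV) (spaceArcs (fsuc j)))
    outflow≡ = sum-flowIf-arcs OutV j (fsuc j) (λ a′ b′ h → proj₁ (rightOf-face⁻ (a′ , b′) h))
                 (λ q h → below-face⇒level _ q h) refl

    slopeEquation-step : SlopeEquation j y′ → SlopeEquation j y
    slopeEquation-step next =
      slope-from-face (coord (inject₁ j) a) (coord (fsuc j) b) (coord (inject₁ j) c) (coord (fsuc j) d)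
                      (+ φ-slope y) (+ φ-slope y′) (+ Sin) (+ Sout) inSpaces outSpaces next conserved
      where
      Sin Sout : ℕ
      Sin = sum (map (flowIf InV) (spaceArcs (inject₁ j)))
      Sout = sum (map (flowIf OutV) (spaceArcs (fsuc j)))
      conserved : + Sin +ℤ + φ-slope y′ ≡ + φ-slope y +ℤ + Sout
      conserved = begin
        + Sin +ℤ + φ-slope y′       ≡⟨ sym (ℤ.pos-+ Sin (φ-slope y′)) ⟩
        + (Sin + φ-slope y′)        ≡⟨ cong +_ (+-comm Sin (φ-slope y′)) ⟩
        + (φ-slope y′ + Sin)        ≡⟨ cong +_ (trans (cong (_+ Sin) (sym inSlopes)) (sym inflow≡)) ⟩
        + inflow G φ v              ≡⟨ cong +_ (conserve v v∈nodes) ⟩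
        + outflow G φ v             ≡⟨ cong +_ (trans outflow≡ (cong (_+ Sout) outSlopes)) ⟩
        + (φ-slope y + Sout)        ≡⟨ ℤ.pos-+ (φ-slope y) Sout ⟩
        + φ-slope y +ℤ + Sout       ∎
        where open ≡-Reasoning

  coord-last : ∀ ℓ → coord ℓ (toℕ (lastOf G ℓ)) ≡ dualR G φ (toℕ ℓ)
  coord-last ℓ rewrite toℕ-fromℕ (pw ℓ) | n∸n≡0 (pw ℓ) = refl

  rSlope-toℕ : ∀ j → rSlope G φ (toℕ j) ≡ φ (slope j (lastOf G (inject₁ j)) (lastOf G (fsuc j)))
  rSlope-toℕ j with toℕ j <? m
  ... | yes j<m rewrite fromℕ<-toℕ j j<m = refl
  ... | no j≮m = ⊥-elim (j≮m (toℕ<n j))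

  slopeEquation-rightmost : ∀ j → SlopeEquation j (rightmostEdge j)
  slopeEquation-rightmost j = begin
    coord (fsuc j) (toℕ (lastOf G (fsuc j)))
      ≡⟨ coord-last (fsuc j) ⟩
    dualR G φ (toℕ j) +ℤ + rSlope G φ (toℕ j)
      ≡⟨ cong₂ (λ k f → dualR G φ k +ℤ + f) (sym (toℕ-inject₁ j)) (rSlope-toℕ j) ⟩
    dualR G φ (toℕ (inject₁ j)) +ℤ + φ (slope j (lastOf G (inject₁ j)) (lastOf G (fsuc j)))
      ≡⟨ cong (_+ℤ + φ (slope j (lastOf G (inject₁ j)) (lastOf G (fsuc j)))) (sym (coord-last (inject₁ j))) ⟩
    coord (inject₁ j) (toℕ (lastOf G (inject₁ j))) +ℤ + φ (slope j (lastOf G (inject₁ j)) (lastOf G (fsuc j))) ∎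
    where open ≡-Reasoning

  -- Induction from the right, on the number of edges of the strip after y.
  slopeEquation-suffix : ∀ j post pre y → edgesIn G j ≡ pre ++ y ∷ post → SlopeEquation j y
  slopeEquation-suffix j [] pre y edgesIn≡
    with ∈-++⁻ pre (subst (rightmostEdge j ∈_) edgesIn≡ (∈-edgesIn⁺ j _ _ (rightPath j)))
  ... | inj₂ (here refl) = slopeEquation-rightmost j
  ... | inj₁ r∈pre with All.lookup (proj₁ (AllPairs-++⁻ pre (subst (AllPairs _<ₑ_) edgesIn≡ (edgesIn-sorted j)))) r∈pre
  ...   | r<y ∷ [] = ⊥-elim (not-<ₗₑₓ-last y (subst (_<ₗₑₓ key y) (cong₂ _,_ (toℕ-fromℕ _) (toℕ-fromℕ _)) r<y))
  slopeEquation-suffix j (y′ ∷ post) pre y edgesIn≡ =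
    BetweenEdges.slopeEquation-step j pre y y′ post edgesIn≡
      (slopeEquation-suffix j post (pre ++ y ∷ []) y′ (trans edgesIn≡ (sym (++-assoc pre (y ∷ []) (y′ ∷ post)))))

  slopeEquation : ∀ j a b → edge j a b ≡ true → SlopeEquation j (a , b)
  slopeEquation j a b ab∈E with ∈-∃++ (∈-edgesIn⁺ j a b ab∈E)
  ... | pre , post , edgesIn≡ = slopeEquation-suffix j post pre (a , b) edgesIn≡

  isLambdaDrawing : IsLambdaDrawing G λ′ (dual G φ)
  isLambdaDrawing = record
    { order = λ ℓ p q p<q → coord-strictMono ℓ p<q (toℕ≤pred[n] q)
    ; noCross = noCross
    ; slopeLow = λ j a b ab∈E → subst (coord (inject₁ j) (toℕ a) ≤ℤ_) (sym (slopeEquation j a b ab∈E))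
                                      (ℤ.i≤i+j (coord (inject₁ j) (toℕ a)) (+ φ (slope j a b)))
    ; slopeHigh = λ j a b ab∈E → subst (_<ℤ coord (inject₁ j) (toℕ a) +ℤ + λ′) (sym (slopeEquation j a b ab∈E))
                                       (ℤ.+-monoʳ-< (coord (inject₁ j) (toℕ a)) (+<+ (slope<λ j a b ab∈E)))
    }
    where
    slope<λ : ∀ j a b → edge j a b ≡ true → φ (slope j a b) < λ′
    slope<λ j a b ab∈E = subst (_≤ λ′) (+-comm (φ (slope j a b)) 1) (upper (slope j a b) (slopeArc∈arcs j a b ab∈E))
    noCross : ∀ j a b c d → edge j a b ≡ true → edge j c d ≡ true →
      coord (inject₁ j) (toℕ a) <ℤ coord (inject₁ j) (toℕ c) → coord (fsuc j) (toℕ b) ≤ℤ coord (fsuc j) (toℕ d)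
    noCross j a b c d ab∈E cd∈E xa<xc with toℕ a <? toℕ c
    ... | yes a<c = coord-mono (fsuc j) (planar j a b c d ab∈E cd∈E a<c) (toℕ≤pred[n] d)
    ... | no a≮c = ⊥-elim (ℤ.<⇒≱ xa<xc (coord-mono (inject₁ j) (≮⇒≥ a≮c) (toℕ≤pred[n] a)))

lemma2 : (G : LevelGraph) → IsEmbeddedWithBoundary G →
         (λ' : ℕ) (φ : Arc G → ℕ) → IsCirculation G λ' φ →
         IsLambdaDrawing G λ' (dual G φ)
lemma2 G emb λ' φ circ = Dual.isLambdaDrawing G emb λ' φ circ
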